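{- For every string $w$, $m(w) \le b(w)$, where $m(w)$ is the size of the smallest internal macro system generating $w$ and $b(w)$ is the number of phrases of the smallest bidirectional macro scheme for $w$.
   Context: Bidirectional macro scheme: for a string $w[1,n]$, a bidirectional macro scheme of size $k$ is a sequence $(x_1,s_1),\ldots,(x_k,s_k)$ with $w = x_1\cdots x_k$, where $x_i = w[s_i, s_i+|x_i|-1]$ if $|x_i|>1$, and $s_i=\bot$ if $|x_i|=1$ (a phrase of length 1 may also be given explicitly). Let $p_i = 1+\sum_{j<i}|x_j|$ be the starting position of $x_i$. The induced function $f:[1,n]\to[1,n]\cup\{\bot\}$ is defined, for a position $i$ with $p_j \le i < p_{j+1}$, by $f(i)=\bot$ if $s_j=\bot$ and $f(i) = s_j + i - p_j$ otherwise. The scheme is valid if for every position $i$ there is $r$ with $f^r(i)=\bot$. $b(w)$ is the minimum size $k$ of a valid bidirectional macro scheme for $w$. Macro system: a tuple $M=(V,\Sigma,R,S)$ with $V$ a finite set of variables, $\Sigma$ a finite set of terminals disjoint from $V$, $S\in V$ the initial variable, and $R$ assigning to each variable $A$ exactly one rule $A\to\alpha$ with $\alpha \in (V\cup\Sigma\cup\{A'[i,j] : A'\in V,\ i,j\in\mathbb{N}\})^*$ (symbols $A'[i,j]$ are called extractions); the rule $A\to\varepsilon$ is allowed only for $A=S$. Its size is $\sum_{A\in V}|R(A)|$, each extraction counting as one symbol. Expansions are defined by $exp(a)=a$ for $a\in\Sigma$, $exp(A)=exp(B_1)\cdots exp(B_k)$ if $A\to B_1\cdots B_k$ (and $exp(S)=\varepsilon$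 if $S\to\varepsilon$), and $exp(A[i,j]) = exp(A)[i,j]$ (substring). The macro system is valid if these equations have a single solution $w=exp(S)\in\Sigma^*$; it then generates $w$. It is internal if $exp(A)$ appears as a substring of $w$ for every $A\in V$. $m(w)$ is the size of the smallest valid internal macro system generating $w$. -}

module Defs where

open import Data.Nat using (ℕ; zero; suc; _+_; _∸_; _≤_; _<_; _<?_)
open import Data.List using (List; []; _∷_; _++_; length; take; drop; concat; map; allFin)
open import Data.Nat.ListAction using (sum)
open import Data.Maybe using (Maybe; just; nothing)
open import Data.Fin using (Fin)
open import Data.Product using (Σ; ∃; ∃-syntax; _×_; _,_)
open import Relation.Binary.PropositionalEquality using (_≡_; _≢_)
open import Relation.Nullary using (yes; no)

-- Strings are lists over an arbitrary alphabet A; positions are 1-based.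

substr : {A : Set} → List A → ℕ → ℕ → List A
substr w i len = take len (drop (i ∸ 1) w)

-- A phrase (x_i , s_i): its content x_i and its source s_i (nothing = ⊥).
record Phrase (A : Set) : Set where
  constructor phrase
  field
    str : List A
    src : Maybe ℕ
open Phrase public

data PhraseOK {A : Set} (w : List A) : Phrase A → Set where
  explicit : ∀ {x} → length x ≡ 1 → PhraseOK w (phrase x nothing)
  copy     : ∀ {x s} → 1 < length x → 1 ≤ s → s + length x ∸ 1 ≤ length w →
             substr w s (length x) ≡ x → PhraseOK w (phrase x (just s))

data AllOK {A : Set} (w : List A) : List (Phrase A) → Set where
  []  : AllOK w []
  _∷_ : ∀ {ph phs} → PhraseOK w ph → AllOK w phs → AllOK w (ph ∷ phs)

concatPhrases : {A : Set} → List (Phrase A) → List A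
concatPhrases phs = concat (map str phs)

-- induced function f, given the starting position p of the first phrase;
-- meant to be applied to positions i ≥ p (outside [1,n] the value is irrelevant).
inducedFrom : {A : Set} → List (Phrase A) → ℕ → ℕ → Maybe ℕ
inducedFrom [] p i = nothing
inducedFrom (ph ∷ phs) p i with i <? p + length (str ph)
... | yes _ with src ph
...   | nothing = nothing
...   | just s  = just (s + (i ∸ p))
inducedFrom (ph ∷ phs) p i | no _ = inducedFrom phs (p + length (str ph)) i

induced : {A : Set} → List (Phrase A) → ℕ → Maybe ℕ
induced phs = inducedFrom phs 1

iterF : (ℕ → Maybe ℕ) → ℕ → ℕ → Maybe ℕ
iterF f zero    i = just i
iterF f (suc r) i with iterF f r i
... | nothing = nothing
... | just j  = f j

ValidBMS : {A : Set} → List A → List (Phrase A) → Set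
ValidBMS w phs =
  AllOK w phs × concatPhrases phs ≡ w ×
  (∀ i → 1 ≤ i → i ≤ length w → ∃[ r ] iterF (induced phs) r i ≡ nothing)

data Sym (A : Set) (v : ℕ) : Set where
  term : A → Sym A v
  var  : Fin v → Sym A v
  ext  : Fin v → ℕ → ℕ → Sym A v

record MacroSystem (A : Set) (v : ℕ) : Set where
  field
    start    : Fin v
    rule     : Fin v → List (Sym A v)
    nonEmpty : ∀ X → X ≢ start → rule X ≢ []
open MacroSystem public

size : {A : Set} {v : ℕ} → MacroSystem A v → ℕ
size {v = v} M = sum (map (λ X → length (rule M X)) (allFin v))

symExp : {A : Set} {v : ℕ} → (Fin v → List A) → Sym A v → List A
symExp e (term a)    = a ∷ []
symExp e (var X)     = e X
symExp e (ext X i j) = substr (e X) i (suc j ∸ i)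

data SymDefined {A : Set} {v : ℕ} (e : Fin v → List A) : Sym A v → Set where
  termD : ∀ a → SymDefined e (term a)
  varD  : ∀ X → SymDefined e (var X)
  extD  : ∀ X i j → 1 ≤ i → i ≤ j → j ≤ length (e X) → SymDefined e (ext X i j)

data AllDefined {A : Set} {v : ℕ} (e : Fin v → List A) : List (Sym A v) → Set where
  []  : AllDefined e []
  _∷_ : ∀ {s ss} → SymDefined e s → AllDefined e ss → AllDefined e (s ∷ ss)

Solution : {A : Set} {v : ℕ} → MacroSystem A v → (Fin v → List A) → Set
Solution M e = ∀ X → AllDefined e (rule M X) × e X ≡ concat (map (symExp e) (rule M X))

-- Valid (unique solution), generates w, and internal.
ValidInternalGenerating : {A : Set} {v : ℕ} → MacroSystem A v → List A → Set
ValidInternalGenerating {A} {v} M w =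
  Σ (Fin v → List A) λ e →
    Solution M e ×
    (∀ e′ → Solution M e′ → ∀ X → e′ X ≡ e X) ×
    e (start M) ≡ w ×
    (∀ X → ∃[ u ] ∃[ u′ ] u ++ e X ++ u′ ≡ w)

-- A bidirectional macro scheme turns into a macro system with a single variable S, whose
-- rule lists the phrases in order: an explicit phrase becomes its terminal and a copied
-- phrase w[s, s+|x|-1] becomes the extraction S[s, s+|x|-1]. The text w solves the expansion
-- equations, and since exp(S) = w this system is internal and has exactly b(w) symbols. The
-- solution is unique because every solution u obeys the same copy equations u[i] = u[f(i)]
-- as w does and agrees with w on explicit positions; validity of the scheme says that every
-- chain i, f(i), f(f(i)), ... ends at an explicit position, so u and w agree everywhere.
module Submission where

open import Defs
open import Data.Nat using (ℕ; zero; suc; _+_; _∸_; _≤_; _<_; _<?_; _⊓_; z≤n; s≤s)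
open import Data.Nat.Properties
open import Data.List using (List; []; _∷_; _++_; length; take; drop; concat; map)
open import Data.List.Properties using (++-identityʳ; length-++; length-take; length-drop)
open import Data.Maybe using (Maybe; just; nothing)
open import Data.Fin using (Fin)
import Data.Fin as Fin
open import Data.Product using (Σ; ∃-syntax; _×_; _,_; proj₁; proj₂)
open import Data.Empty using (⊥-elim)
open import Function using (id)
open import Relation.Binary.PropositionalEquality
open import Relation.Nullary using (yes; no)

infixl 5 _!?_

_!?_ : {A : Set} → List A → ℕ → Maybe A
[]       !? _     = nothing
(x ∷ xs) !? zero  = just x
(x ∷ xs) !? suc k = xs !? k

module _ {A : Set} where

  !?-++ˡ : (xs ys : List A) {k : ℕ} → k < length xs → (xs ++ ys) !? k ≡ xs !? k
  !?-++ˡ (x ∷ xs) ys {zero}  _       = refl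
  !?-++ˡ (x ∷ xs) ys {suc k} (s≤s k<) = !?-++ˡ xs ys k<

  !?-++ʳ : (xs ys : List A) (k : ℕ) → (xs ++ ys) !? (length xs + k) ≡ ys !? k
  !?-++ʳ []       ys k = refl
  !?-++ʳ (x ∷ xs) ys k = !?-++ʳ xs ys k

  !?-take : (n : ℕ) (xs : List A) {k : ℕ} → k < n → take n xs !? k ≡ xs !? k
  !?-take (suc n) []       _                = refl
  !?-take (suc n) (x ∷ xs) {zero}  _        = refl
  !?-take (suc n) (x ∷ xs) {suc k} (s≤s k<) = !?-take n xs k<

  !?-drop : (n : ℕ) (xs : List A) (k : ℕ) → drop n xs !? k ≡ xs !? (n + k)
  !?-drop zero    xs       k = refl
  !?-drop (suc n) []       k = refl
  !?-drop (suc n) (x ∷ xs) k = !?-drop n xs k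

  !?-extensionality : (xs ys : List A) → length xs ≡ length ys →
                      (∀ k → k < length xs → xs !? k ≡ ys !? k) → xs ≡ ys
  !?-extensionality []       []       _   _ = refl
  !?-extensionality (x ∷ xs) (y ∷ ys) len agree with agree zero (s≤s z≤n)
  ... | refl = cong (x ∷_) (!?-extensionality xs ys (suc-injective len)
                              (λ k k< → agree (suc k) (s≤s k<)))

  substr-!? : (v : List A) (s′ L : ℕ) {k : ℕ} → k < L → substr v (suc s′) L !? k ≡ v !? (s′ + k)
  substr-!? v s′ L {k} k<L = trans (!?-take L (drop s′ v) k<L) (!?-drop s′ v k)

  length-substr : (v : List A) (s′ L : ℕ) → s′ + L ≤ length v → length (substr v (suc s′) L) ≡ L
  length-substr v s′ L bound = begin
    length (take L (drop s′ v)) ≡⟨ length-take L (drop s′ v) ⟩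
    L ⊓ length (drop s′ v) ≡⟨ cong (L ⊓_) (length-drop s′ v) ⟩
    L ⊓ (length v ∸ s′)    ≡⟨ m≤n⇒m⊓n≡m (subst (_≤ length v ∸ s′) (m+n∸m≡n s′ L) (∸-monoˡ-≤ s′ bound)) ⟩
    L                      ∎
    where open ≡-Reasoning

Backward : (R P : ℕ → Set) → ℕ → Maybe ℕ → Set
Backward R P i nothing  = P i
Backward R P i (just j) = R j × (P j → P i)

module _ (f : ℕ → Maybe ℕ) (R P : ℕ → Set) (step : ∀ i → R i → Backward R P i (f i)) where

  iterF-just-backward : ∀ r i j → R i → iterF f r i ≡ just j → R j × (P j → P i)
  iterF-just-backward zero    i .i Ri refl = Ri , id
  iterF-just-backward (suc r) i j  Ri eq with iterF f r i | iterF-just-backward r i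
  ... | just k | ih with ih k Ri refl
  ...   | Rk , Pk→Pi with f k | step k Rk
  ...     | just j′ | Rj′ , Pj′→Pk with refl ← eq = Rj′ , λ Pj → Pk→Pi (Pj′→Pk Pj)

  iterF-nothing-backward : ∀ r i → R i → iterF f r i ≡ nothing → P i
  iterF-nothing-backward (suc r) i Ri eq
    with iterF f r i | iterF-nothing-backward r i | iterF-just-backward r i
  ... | nothing | ih | _  = ih Ri refl
  ... | just k  | _  | ch with ch k Ri refl
  ...   | Rk , Pk→Pi with f k | step k Rk
  ...     | nothing | Pk = Pk→Pi Pk

S : Fin 1
S = Fin.zero

module _ {A : Set} {w : List A} where

  phraseSym : ∀ {ph} → PhraseOK w ph → Sym A 1
  phraseSym (explicit {a ∷ []} refl) = term a
  phraseSym (copy {x} {s} _ _ _ _)   = ext S s (s + length x ∸ 1)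

  phraseSyms : ∀ {phs} → AllOK w phs → List (Sym A 1)
  phraseSyms []         = []
  phraseSyms (ok ∷ oks) = phraseSym ok ∷ phraseSyms oks

  length-phraseSyms : ∀ {phs} (oks : AllOK w phs) → length (phraseSyms oks) ≡ length phs
  length-phraseSyms []         = refl
  length-phraseSyms (ok ∷ oks) = cong suc (length-phraseSyms oks)

  oneVariableSystem : ∀ {phs} → AllOK w phs → MacroSystem A 1
  oneVariableSystem oks = record
    { start    = S
    ; rule     = λ _ → phraseSyms oks
    ; nonEmpty = λ { Fin.zero S≢S → ⊥-elim (S≢S refl) }
    }

  size-oneVariableSystem : ∀ {phs} (oks : AllOK w phs) → size (oneVariableSystem oks) ≡ length phs
  size-oneVariableSystem oks = trans (+-identityʳ _) (length-phraseSyms oks)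

  expandSyms : (Fin 1 → List A) → List (Sym A 1) → List A
  expandSyms e ss = concat (map (symExp e) ss)

  expand-copy : (e : Fin 1 → List A) (s′ L : ℕ) → symExp e (ext S (suc s′) (s′ + L)) ≡ substr (e S) (suc s′) L
  expand-copy e s′ L = cong (λ n → take n (drop s′ (e S))) (m+n∸m≡n s′ L)

  module TextSolves where

    text : Fin 1 → List A
    text _ = w

    phraseSym-defined : ∀ {ph} (ok : PhraseOK w ph) → SymDefined text (phraseSym ok)
    phraseSym-defined (explicit {a ∷ []} refl)                     = termD a
    phraseSym-defined (copy {x} {suc s′} 1<|x| (s≤s z≤n) bound _) =
      extD S (suc s′) (s′ + length x) (s≤s z≤n)
        (subst (_≤ s′ + length x) (+-comm s′ 1) (+-monoʳ-≤ s′ (<⇒≤ 1<|x|))) bound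

    phraseSym-expands : ∀ {ph} (ok : PhraseOK w ph) → symExp text (phraseSym ok) ≡ str ph
    phraseSym-expands (explicit {a ∷ []} refl)                   = refl
    phraseSym-expands (copy {x} {suc s′} _ (s≤s z≤n) _ source) = trans (expand-copy text s′ (length x)) source

    phraseSyms-defined : ∀ {phs} (oks : AllOK w phs) → AllDefined text (phraseSyms oks)
    phraseSyms-defined []         = []
    phraseSyms-defined (ok ∷ oks) = phraseSym-defined ok ∷ phraseSyms-defined oks

    phraseSyms-expand : ∀ {phs} (oks : AllOK w phs) → expandSyms text (phraseSyms oks) ≡ concatPhrases phs
    phraseSyms-expand []         = refl
    phraseSyms-expand (ok ∷ oks) = cong₂ _++_ (phraseSym-expands ok) (phraseSyms-expand oks)

    text-solves : ∀ {phs} (oks : AllOK w phs) → concatPhrases phs ≡ w → Solution (oneVariableSystem oks) text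
    text-solves oks concat≡w _ = phraseSyms-defined oks , sym (trans (phraseSyms-expand oks) concat≡w)

  module SolutionFollowsScheme (e : Fin 1 → List A) where

    u : List A
    u = e S

    InText : ℕ → Set
    InText j = 1 ≤ j × j ≤ length w

    AgreesAt : ℕ → Set
    AgreesAt j = u !? (j ∸ 1) ≡ w !? (j ∸ 1)

    Follows : Maybe ℕ → Maybe A → Maybe A → Set
    Follows nothing  a b = a ≡ b
    Follows (just j) a b = InText j × a ≡ u !? (j ∸ 1) × b ≡ w !? (j ∸ 1)

    length-expandSym : ∀ {ph} (ok : PhraseOK w ph) → SymDefined e (phraseSym ok) →
                       length (symExp e (phraseSym ok)) ≡ length (str ph)
    length-expandSym (explicit {a ∷ []} refl) _ = refl
    length-expandSym (copy {x} {suc s′} _ (s≤s z≤n) _ _) (extD _ _ _ _ _ end≤|u|) =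
      trans (cong length (expand-copy e s′ (length x))) (length-substr u s′ (length x) end≤|u|)

    length-expandSyms : ∀ {phs} (oks : AllOK w phs) → AllDefined e (phraseSyms oks) →
                        length (expandSyms e (phraseSyms oks)) ≡ length (concatPhrases phs)
    length-expandSyms []         []         = refl
    length-expandSyms {ph ∷ _} (ok ∷ oks) (def ∷ defs) =
      trans (length-++ (symExp e (phraseSym ok)))
        (trans (cong₂ _+_ (length-expandSym ok def) (length-expandSyms oks defs))
          (sym (length-++ (str ph))))

    follows-after-phrase : ∀ {ph phs} (ok : PhraseOK w ph) (oks : AllOK w phs) → SymDefined e (phraseSym ok) →
      ∀ p k′ → let L = length (str ph) in
      Follows (inducedFrom phs (p + L) (p + L + k′)) (expandSyms e (phraseSyms oks) !? k′) (concatPhrases phs !? k′) →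
      Follows (inducedFrom phs (p + L) (p + (L + k′)))
              (expandSyms e (phraseSyms (ok ∷ oks)) !? (L + k′)) (concatPhrases (ph ∷ phs) !? (L + k′))
    follows-after-phrase {ph} {phs} ok oks def p k′ rest-follows
      rewrite sym (+-assoc p (length (str ph)) k′)
            | sym (length-expandSym ok def)
            | !?-++ʳ (symExp e (phraseSym ok)) (expandSyms e (phraseSyms oks)) k′
            | length-expandSym ok def
            | !?-++ʳ (str ph) (concatPhrases phs) k′
            = rest-follows

    follows-in-copy : ∀ {x s′ phs} (ok : PhraseOK w (phrase x (just (suc s′)))) (oks : AllOK w phs) →
      SymDefined e (phraseSym ok) → ∀ {k} → k < length x →
      Follows (just (suc s′ + k)) (expandSyms e (phraseSyms (ok ∷ oks)) !? k) (concatPhrases (phrase x (just (suc s′)) ∷ phs) !? k)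
    follows-in-copy {x} {s′} {phs} ok@(copy _ (s≤s z≤n) bound source) oks (extD _ _ _ _ _ end≤|u|) {k} k<|x| =
      (s≤s z≤n , ≤-trans (+-monoʳ-< s′ k<|x|) bound) , expansion , scheme
      where
        L : ℕ
        L = length x

        rest : List A
        rest = expandSyms e (phraseSyms oks)

        expansion : (symExp e (phraseSym ok) ++ rest) !? k ≡ u !? (s′ + k)
        expansion = begin
          (symExp e (phraseSym ok) ++ rest) !? k ≡⟨ cong (λ y → (y ++ rest) !? k) (expand-copy e s′ L) ⟩
          (substr u (suc s′) L ++ rest) !? k     ≡⟨ !?-++ˡ (substr u (suc s′) L) rest
                                                      (subst (k <_) (sym (length-substr u s′ L end≤|u|)) k<|x|) ⟩
          substr u (suc s′) L !? k               ≡⟨ substr-!? u s′ L k<|x| ⟩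
          u !? (s′ + k)                          ∎
          where open ≡-Reasoning

        scheme : (x ++ concatPhrases phs) !? k ≡ w !? (s′ + k)
        scheme = begin
          (x ++ concatPhrases phs) !? k ≡⟨ !?-++ˡ x (concatPhrases phs) k<|x| ⟩
          x !? k                        ≡⟨ cong (_!? k) (sym source) ⟩
          substr w (suc s′) L !? k      ≡⟨ substr-!? w s′ L k<|x| ⟩
          w !? (s′ + k)                 ∎
          where open ≡-Reasoning

    -- The phrases phs start at the 1-based position p; k is a 0-based offset into them.
    follows-in-phrases : ∀ {phs} (oks : AllOK w phs) → AllDefined e (phraseSyms oks) →
                         ∀ p k → k < length (concatPhrases phs) →
                         Follows (inducedFrom phs p (p + k)) (expandSyms e (phraseSyms oks) !? k) (concatPhrases phs !? k)
    follows-in-phrases [] [] p k ()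
    follows-in-phrases (ok@(explicit {a ∷ []} refl) ∷ oks) (def ∷ defs) p k k<
      with p + k <? p + 1
    ... | yes k<1+p = trans (!?-++ˡ (a ∷ []) _ k<1) (sym (!?-++ˡ (a ∷ []) _ k<1))
      where
        k<1 : k < 1
        k<1 = +-cancelˡ-< p k 1 k<1+p
    ... | no k≮1+p with m≤n⇒∃[o]m+o≡n (+-cancelˡ-≤ p 1 k (≮⇒≥ k≮1+p))
    ...   | k′ , refl = follows-after-phrase ok oks def p k′
                          (follows-in-phrases oks defs (p + 1) k′ (+-cancelˡ-< 1 k′ _ k<))
    follows-in-phrases {phrase x _ ∷ _} (ok@(copy {x} {suc s′} _ (s≤s z≤n) _ _) ∷ oks) (def ∷ defs) p k k<
      with p + k <? p + length x
    ... | yes k<p+L rewrite m+n∸m≡n p k = follows-in-copy ok oks def (+-cancelˡ-< p k (length x) k<p+L)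
    ... | no k≮p+L with m≤n⇒∃[o]m+o≡n (+-cancelˡ-≤ p (length x) k (≮⇒≥ k≮p+L))
    ...   | k′ , refl = follows-after-phrase ok oks def p k′
                          (follows-in-phrases oks defs (p + length x) k′
                            (+-cancelˡ-< (length x) k′ _ (subst (length x + k′ <_) (length-++ x) k<)))

    follows-backward : ∀ {i} m → Follows m (u !? (i ∸ 1)) (w !? (i ∸ 1)) →
                       Backward InText AgreesAt i m
    follows-backward nothing  agree                     = agree
    follows-backward (just j) (inText , u-copy , w-copy) = inText , λ agree → trans u-copy (trans agree (sym w-copy))

    solution-is-text : ∀ {phs} (oks : AllOK w phs) → concatPhrases phs ≡ w →
                       (∀ i → 1 ≤ i → i ≤ length w → ∃[ r ] iterF (induced phs) r i ≡ nothing) →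
                       Solution (oneVariableSystem oks) e → u ≡ w
    solution-is-text {phs} oks concat≡w valid solves = !?-extensionality u w |u|≡|w| agree
      where
        defs : AllDefined e (phraseSyms oks)
        defs = proj₁ (solves S)

        u≡ : u ≡ expandSyms e (phraseSyms oks)
        u≡ = proj₂ (solves S)

        |u|≡|w| : length u ≡ length w
        |u|≡|w| = trans (cong length u≡) (trans (length-expandSyms oks defs) (cong length concat≡w))

        step : ∀ i → InText i → Backward InText AgreesAt i (induced phs i)
        step (suc k) (_ , k<|w|) =
          follows-backward (induced phs (suc k))
            (subst₂ (Follows (induced phs (suc k))) (cong (_!? k) (sym u≡)) (cong (_!? k) concat≡w)
              (follows-in-phrases oks defs 1 k (subst (k <_) (cong length (sym concat≡w)) k<|w|)))

        agree : ∀ k → k < length u → u !? k ≡ w !? k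
        agree k k<|u| =
          let k<|w|         = subst (k <_) |u|≡|w| k<|u|
              r , reaches⊥  = valid (suc k) (s≤s z≤n) k<|w|
          in iterF-nothing-backward (induced phs) InText AgreesAt step r (suc k) (s≤s z≤n , k<|w|) reaches⊥

theorem1 : {A : Set} (w : List A) (bms : List (Phrase A)) → ValidBMS w bms →
    ∃[ v ] Σ (MacroSystem A v) λ M → ValidInternalGenerating M w × size M ≤ length bms
theorem1 w bms (oks , concat≡w , valid) =
  1 , oneVariableSystem oks ,
  (text , text-solves oks concat≡w , unique , refl , (λ _ → [] , [] , ++-identityʳ w)) ,
  ≤-reflexive (size-oneVariableSystem oks)
  where
    open TextSolves
    unique : ∀ e → Solution (oneVariableSystem oks) e → ∀ X → e X ≡ w
    unique e solves Fin.zero = SolutionFollowsScheme.solution-is-text e oks concat≡w valid solves
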